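{- If a finite set $X$ of linear $\lambda$-terms is duplicable, then all terms in $X$ are closed.
   Context: Pure $\lambda$-calculus with $\beta$- and $\eta$-reduction, $\rightarrow^*_{\beta\eta}$ the reflexive-transitive closure of their union. A $\lambda$-term $M$ is linear if each of its free variables occurs exactly once in it and every subterm $\lambda x.M'$ is such that $x$ occurs in $M'$ and $M'$ is linear. $\langle M,N\rangle=\lambda z.zMN$. A set $X$ of linear $\lambda$-terms is duplicable if there exists a linear $\lambda$-term $\mathtt{D}_X$ such that, for all $M\in X$, $\mathtt{D}_X\,M\rightarrow^*_{\beta\eta}\langle M,M\rangle$ and $FV(\mathtt{D}_X)\cap FV(M)=\emptyset$. -}

module Defs where

open import Data.Nat using (ℕ; zero; suc; _+_; _≤_; _≥_)
open import Data.Product using (_×_; Σ)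
open import Data.Sum using (_⊎_)
open import Data.Unit using (⊤)
open import Data.List using (List)
open import Data.List.Membership.Propositional using (_∈_)
open import Relation.Binary.PropositionalEquality using (_≡_)
open import Relation.Nullary using (yes; no)
open import Relation.Binary.Construct.Closure.ReflexiveTransitive using (Star)

-- Pure λ-terms, de Bruijn indices (terms are identified up to α-equivalence).
data Term : Set where
  var : ℕ → Term
  app : Term → Term → Term
  lam : Term → Term

ext : (ℕ → ℕ) → ℕ → ℕ
ext ρ zero    = zero
ext ρ (suc i) = suc (ρ i)

rename : (ℕ → ℕ) → Term → Term
rename ρ (var i)   = var (ρ i)
rename ρ (app M N) = app (rename ρ M) (rename ρ N)
rename ρ (lam M)   = lam (rename (ext ρ) M)

exts : (ℕ → Term) → ℕ → Term
exts σ zero    = var zero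
exts σ (suc i) = rename suc (σ i)

subst : (ℕ → Term) → Term → Term
subst σ (var i)   = σ i
subst σ (app M N) = app (subst σ M) (subst σ N)
subst σ (lam M)   = lam (subst (exts σ) M)

-- single substitution M[0 := N], lowering the other free indices
single : Term → ℕ → Term
single N zero    = N
single N (suc i) = var i

_[_] : Term → Term → Term
M [ N ] = subst (single N) M

infix 4 _→βη_ _→βη*_
data _→βη_ : Term → Term → Set where
  β    : ∀ {M N} → app (lam M) N →βη M [ N ]
  η    : ∀ {M} → lam (app (rename suc M) (var zero)) →βη M
  appL : ∀ {M M' N} → M →βη M' → app M N →βη app M' N
  appR : ∀ {M N N'} → N →βη N' → app M N →βη app M N'
  ξ    : ∀ {M M'} → M →βη M' → lam M →βη lam M'

_→βη*_ : Term → Term → Set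
_→βη*_ = Star _→βη_

occ : ℕ → Term → ℕ
occ i (var j) with i Data.Nat.≟ j
... | yes _ = 1
... | no  _ = 0
occ i (app M N) = occ i M + occ i N
occ i (lam M)   = occ (suc i) M

-- free variables of M: indices i with occ i M ≥ 1
-- Linear terms: every free variable occurs exactly once (equivalently, at
-- most once, since a free variable occurs at least once by definition), and
-- every subterm λx.M' has x occurring in M' and M' linear.
mutual
  Linear : Term → Set
  Linear M = (∀ i → occ i M ≤ 1) × LamOK M

  LamOK : Term → Set
  LamOK (var i)   = ⊤
  LamOK (app M N) = LamOK M × LamOK N
  LamOK (lam M)   = (occ zero M ≥ 1) × Linear M

Closed : Term → Set
Closed M = ∀ i → occ i M ≡ 0

DisjointFV : Term → Term → Set
DisjointFV D M = ∀ i → occ i D ≡ 0 ⊎ occ i M ≡ 0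

-- ⟨M,N⟩ = λz.zMN
⟨_,_⟩ : Term → Term → Term
⟨ M , N ⟩ = lam (app (app (var zero) (rename suc M)) (rename suc N))

-- A finite set X of linear terms is given as a list.
Duplicable : List Term → Set
Duplicable X = Σ Term λ D → Linear D ×
  (∀ {M} → M ∈ X → (app D M →βη* ⟨ M , M ⟩) × DisjointFV D M)

-- Affine terms (every bound variable occurs at most once) are closed under
-- βη-reduction, which never increases the number of occurrences of a free
-- variable in them; linear terms are affine. If D M ↠ ⟨M,M⟩ and x is free in
-- M, then x is not free in D, so its 2·occ x M occurrences in ⟨M,M⟩ are
-- bounded by its occ x M occurrences in D M, forcing occ x M = 0.
module Submission where

open import Defs
open import Data.List using (List)
open import Data.List.Relation.Unary.All using (All)
open import Data.List.Membership.Propositional using (_∈_)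

open import Data.Nat using (ℕ; zero; suc; _+_; _*_; _≤_; z≤n; _≟_)
open import Data.Nat.Properties
open import Data.Nat.Tactic.RingSolver using (solve-∀)
open import Data.Product using (_×_; _,_)
open import Data.Sum using (inj₁; inj₂)
open import Data.Unit using (⊤; tt)
open import Data.Empty using (⊥-elim)
open import Function.Definitions using (Injective)
open import Relation.Nullary using (yes; no)
open import Relation.Binary.PropositionalEquality
  using (_≡_; _≢_; refl; sym; cong; cong₂; subst₂)
  renaming (subst to transport)
open import Relation.Binary.Construct.Closure.ReflexiveTransitive using (ε; _◅_)
import Data.List.Relation.Unary.All as All

occ-var-self : ∀ i → occ i (var i) ≡ 1
occ-var-self i with i ≟ i
... | yes _  = refl
... | no i≢i = ⊥-elim (i≢i refl)

occ-var-other : ∀ {i j} → i ≢ j → occ i (var j) ≡ 0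
occ-var-other {i} {j} i≢j with i ≟ j
... | yes i≡j = ⊥-elim (i≢j i≡j)
... | no _    = refl

occ-suc-var : ∀ i j → occ (suc i) (var (suc j)) ≡ occ i (var j)
occ-suc-var i j with i ≟ j
... | yes refl = occ-var-self (suc i)
... | no i≢j   = occ-var-other (λ e → i≢j (suc-injective e))

InjectiveRenaming : (ℕ → ℕ) → Set
InjectiveRenaming ρ = Injective _≡_ _≡_ ρ

ext-injective : ∀ {ρ} → InjectiveRenaming ρ → InjectiveRenaming (ext ρ)
ext-injective inj {zero}  {zero}  _ = refl
ext-injective inj {suc a} {suc b} e = cong suc (inj (suc-injective e))

occ-rename-injective : ∀ {ρ} → InjectiveRenaming ρ →
                       ∀ k M → occ (ρ k) (rename ρ M) ≡ occ k M
occ-rename-injective {ρ} inj k (var j) with k ≟ j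
... | yes refl = occ-var-self (ρ k)
... | no k≢j   = occ-var-other (λ e → k≢j (inj e))
occ-rename-injective inj k (app M N) =
  cong₂ _+_ (occ-rename-injective inj k M) (occ-rename-injective inj k N)
occ-rename-injective inj k (lam M) = occ-rename-injective (ext-injective inj) (suc k) M

occ-rename-∉image : ∀ {ρ} k → (∀ j → ρ j ≢ k) → ∀ M → occ k (rename ρ M) ≡ 0
occ-rename-∉image k ∉im (var j)   = occ-var-other (λ e → ∉im j (sym e))
occ-rename-∉image k ∉im (app M N) =
  cong₂ _+_ (occ-rename-∉image k ∉im M) (occ-rename-∉image k ∉im N)
occ-rename-∉image {ρ} k ∉im (lam M) = occ-rename-∉image (suc k) ext-∉im M
  where
  ext-∉im : ∀ j → ext ρ j ≢ suc k
  ext-∉im zero    ()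
  ext-∉im (suc j) e = ∉im j (suc-injective e)

occ-weaken : ∀ k M → occ (suc k) (rename suc M) ≡ occ k M
occ-weaken = occ-rename-injective suc-injective

occ-zero-weaken : ∀ M → occ 0 (rename suc M) ≡ 0
occ-zero-weaken = occ-rename-∉image 0 (λ _ ())

occ-pair-diag : ∀ i M → occ i ⟨ M , M ⟩ ≡ occ i M + occ i M
occ-pair-diag i M
  rewrite occ-weaken i M | occ-var-other {suc i} {zero} (λ ()) = refl

-- σ behaves like a renaming sending r (and nothing else) to k, except at p.
occ-subst-≤ : ∀ σ p k r →
              (∀ j → j ≢ p → occ k (σ j) ≤ occ r (var j)) →
              ∀ M → occ k (subst σ M) ≤ occ r M + occ p M * occ k (σ p)
occ-subst-≤ σ p k r hσ (var j) with j ≟ p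
... | yes refl rewrite occ-var-self p | *-identityˡ (occ k (σ p)) = m≤n+m _ _
... | no j≢p rewrite occ-var-other (λ p≡j → j≢p (sym p≡j)) | +-identityʳ (occ r (var j)) =
  hσ j j≢p
occ-subst-≤ σ p k r hσ (app M N) =
  transport (occ k (subst σ M) + occ k (subst σ N) ≤_)
    (interchange (occ r M) (occ p M) (occ k (σ p)) (occ r N) (occ p N))
    (+-mono-≤ (occ-subst-≤ σ p k r hσ M) (occ-subst-≤ σ p k r hσ N))
  where
  interchange : ∀ a b c d e → (a + b * c) + (d + e * c) ≡ (a + d) + (b + e) * c
  interchange = solve-∀
occ-subst-≤ σ p k r hσ (lam M) =
  transport (λ c → occ (suc k) (subst (exts σ) M) ≤ occ (suc r) M + occ (suc p) M * c)
    (occ-weaken k (σ p))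
    (occ-subst-≤ (exts σ) (suc p) (suc k) (suc r) hexts M)
  where
  hexts : ∀ j → j ≢ suc p → occ (suc k) (exts σ j) ≤ occ (suc r) (var j)
  hexts zero    _ rewrite occ-var-other {suc k} {zero} (λ ()) = z≤n
  hexts (suc j) j≢p rewrite occ-weaken k (σ j) | occ-suc-var r j =
    hσ j (λ e → j≢p (cong suc e))

Affine : Term → Set
Affine (var i)   = ⊤
Affine (app M N) = Affine M × Affine N
Affine (lam M)   = occ 0 M ≤ 1 × Affine M

LamOK⇒Affine : ∀ M → LamOK M → Affine M
LamOK⇒Affine (var i)   _               = tt
LamOK⇒Affine (app M N) (okM , okN)     = LamOK⇒Affine M okM , LamOK⇒Affine N okN
LamOK⇒Affine (lam M)   (_ , occ≤1 , ok) = occ≤1 0 , LamOK⇒Affine M ok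

Linear⇒Affine : ∀ M → Linear M → Affine M
Linear⇒Affine M (_ , ok) = LamOK⇒Affine M ok

Affine-rename : ∀ {ρ} → InjectiveRenaming ρ → ∀ M → Affine M → Affine (rename ρ M)
Affine-rename inj (var i)   _         = tt
Affine-rename inj (app M N) (aM , aN) = Affine-rename inj M aM , Affine-rename inj N aN
Affine-rename inj (lam M)   (o , aM)  =
  transport (_≤ 1) (sym (occ-rename-injective (ext-injective inj) 0 M)) o ,
  Affine-rename (ext-injective inj) M aM

Affine-unrename : ∀ {ρ} → InjectiveRenaming ρ → ∀ M → Affine (rename ρ M) → Affine M
Affine-unrename inj (var i)   _         = tt
Affine-unrename inj (app M N) (aM , aN) = Affine-unrename inj M aM , Affine-unrename inj N aN
Affine-unrename inj (lam M)   (o , aM)  =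
  transport (_≤ 1) (occ-rename-injective (ext-injective inj) 0 M) o ,
  Affine-unrename (ext-injective inj) M aM

Affine-subst : ∀ σ → (∀ j → Affine (σ j)) → ∀ M → Affine M → Affine (subst σ M)
Affine-subst σ aσ (var i)   _         = aσ i
Affine-subst σ aσ (app M N) (aM , aN) = Affine-subst σ aσ M aM , Affine-subst σ aσ N aN
Affine-subst σ aσ (lam M)   (o , aM)  = occ-bound , Affine-subst (exts σ) aexts M aM
  where
  aexts : ∀ j → Affine (exts σ j)
  aexts zero    = tt
  aexts (suc j) = Affine-rename suc-injective (σ j) (aσ j)
  -- exts σ only maps 0 to 0; index 1 may carry σ 0, which does not mention 0.
  hexts : ∀ j → j ≢ 1 → occ 0 (exts σ j) ≤ occ 0 (var j)
  hexts zero          _   = ≤-refl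
  hexts (suc zero)    j≢1 = ⊥-elim (j≢1 refl)
  hexts (suc (suc j)) _   rewrite occ-zero-weaken (σ (suc j)) = z≤n
  occ-bound : occ 0 (subst (exts σ) M) ≤ 1
  occ-bound with occ-subst-≤ (exts σ) 1 0 0 hexts M
  ... | bound rewrite occ-zero-weaken (σ 0) | *-zeroʳ (occ 1 M) | +-identityʳ (occ 0 M) =
    ≤-trans bound o

Affine-single : ∀ N → Affine N → ∀ j → Affine (single N j)
Affine-single N aN zero    = aN
Affine-single N aN (suc j) = tt

occ-reduce-≤ : ∀ {t t'} → Affine t → t →βη t' → ∀ i → occ i t' ≤ occ i t
occ-reduce-≤ {app (lam M) N} ((o , _) , _) β i =
  ≤-trans (occ-subst-≤ (single N) 0 i (suc i) hsingle M)
    (+-monoʳ-≤ (occ (suc i) M) (≤-trans (*-monoˡ-≤ (occ i N) o) (≤-reflexive (+-identityʳ _))))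
  where
  hsingle : ∀ j → j ≢ 0 → occ i (single N j) ≤ occ (suc i) (var j)
  hsingle zero    j≢0 = ⊥-elim (j≢0 refl)
  hsingle (suc j) _   = ≤-reflexive (sym (occ-suc-var i j))
occ-reduce-≤ {t' = M} _ η i
  rewrite occ-weaken i M | occ-var-other {suc i} {zero} (λ ()) = ≤-reflexive (sym (+-identityʳ _))
occ-reduce-≤ (aM , _)  (appL s) i = +-monoˡ-≤ _ (occ-reduce-≤ aM s i)
occ-reduce-≤ (_ , aN)  (appR s) i = +-monoʳ-≤ _ (occ-reduce-≤ aN s i)
occ-reduce-≤ (_ , aM)  (ξ s)    i = occ-reduce-≤ aM s (suc i)

Affine-reduce : ∀ {t t'} → Affine t → t →βη t' → Affine t'
Affine-reduce {app (lam M) N} ((_ , aM) , aN) β = Affine-subst (single N) (Affine-single N aN) M aM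
Affine-reduce {t' = M} (_ , aM , _) η = Affine-unrename suc-injective M aM
Affine-reduce (aM , aN) (appL s) = Affine-reduce aM s , aN
Affine-reduce (aM , aN) (appR s) = aM , Affine-reduce aN s
Affine-reduce (o , aM)  (ξ s)    = ≤-trans (occ-reduce-≤ aM s 0) o , Affine-reduce aM s

occ-reduce*-≤ : ∀ {t t'} → Affine t → t →βη* t' → ∀ i → occ i t' ≤ occ i t
occ-reduce*-≤ a ε        i = ≤-refl
occ-reduce*-≤ a (s ◅ ss) i = ≤-trans (occ-reduce*-≤ (Affine-reduce a s) ss i) (occ-reduce-≤ a s i)

proposition3p7 : (X : List Term) → All Linear X → Duplicable X →
                     ∀ {M} → M ∈ X → Closed M
proposition3p7 _ linX (D , linD , dup) {M} M∈X i with dup M∈X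
... | D·M↠⟨M,M⟩ , disjoint with disjoint i
...   | inj₂ occM≡0 = occM≡0
...   | inj₁ occD≡0 = n≤0⇒n≡0 (+-cancelʳ-≤ (occ i M) (occ i M) 0 twice≤once)
  where
  bound : occ i ⟨ M , M ⟩ ≤ occ i D + occ i M
  bound = occ-reduce*-≤ (Linear⇒Affine D linD , Linear⇒Affine M (All.lookup linX M∈X))
                        D·M↠⟨M,M⟩ i
  twice≤once : occ i M + occ i M ≤ 0 + occ i M
  twice≤once = subst₂ _≤_ (occ-pair-diag i M) (cong (_+ occ i M) occD≡0) bound
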